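{- The theory $\mathbf{IKP}+(\mathrm{AC}_{\mathrm{Set}})$ proves every instance of the schema ($\Delta_0$-LEM) and every instance of the schema (BOS).
   Context: Language: first-order set theory with $\in$ and $=$; $\Delta_0$-formulae are those in which all quantifiers are bounded ($\forall x\in a$, $\exists x\in a$). $\mathbf{IKP}$ is based on intuitionistic logic with axioms: Extensionality, Pair, Union, Infinity (there is a smallest set containing $0$ and closed under $x\mapsto x\cup\{x\}$), Bounded Separation $\exists x\,\forall u[u\in x\leftrightarrow(u\in a\wedge\varphi(u))]$ for $\Delta_0$ $\varphi$, Bounded Collection $\forall x\in a\,\exists y\,\psi(x,y)\to\exists z\,\forall x\in a\,\exists y\in z\,\psi(x,y)$ for $\Delta_0$ $\psi$, and Set Induction for all formulae. ($\mathrm{AC}_{\mathrm{Set}}$): $\forall x\in a\,\exists y\,\psi(x,y)\to\exists f[\mathrm{Fun}(f)\wedge\mathrm{dom}(f)=a\wedge\forall x\in a\,\psi(x,f(x))]$ for all formulae $\psi$. ($\Delta_0$-LEM): $\varphi\vee\neg\varphi$ for all $\Delta_0$-formulae $\varphi$. (BOS): $\forall x\in a[\varphi(x)\vee\neg\varphi(x)]\to[\forall x\in a\,\varphi(x)\vee\exists x\in a\,\neg\varphi(x)]$ for all formulae $\varphi$. -}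

module Defs where

-- Deep embedding of first-order intuitionistic set theory in the language {∈, =}.
-- Variables are de Bruijn indices (ℕ); the language has no function symbols,
-- so terms are just variables.

open import Data.Nat using (ℕ; zero; suc; _+_)
open import Data.List using (List; []; _∷_; map)
open import Data.List.Membership.Propositional using (_∈_)

infix  7 _∈̇_ _≐_
infixr 6 _∧̇_
infixr 5 _∨̇_
infixr 4 _⇒̇_ _⇔̇_
infix  2 _⊢_

data Fm : Set where
  _∈̇_ : ℕ → ℕ → Fm
  _≐_ : ℕ → ℕ → Fm
  ⊥̇   : Fm
  _∧̇_ : Fm → Fm → Fm
  _∨̇_ : Fm → Fm → Fm
  _⇒̇_ : Fm → Fm → Fm
  ∀̇   : Fm → Fm
  ∃̇   : Fm → Fm

-- Renaming (= substitution, since terms are variables)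
ext : (ℕ → ℕ) → ℕ → ℕ
ext σ zero    = zero
ext σ (suc n) = suc (σ n)

rename : (ℕ → ℕ) → Fm → Fm
rename σ (x ∈̇ y) = σ x ∈̇ σ y
rename σ (x ≐ y) = σ x ≐ σ y
rename σ ⊥̇       = ⊥̇
rename σ (φ ∧̇ ψ) = rename σ φ ∧̇ rename σ ψ
rename σ (φ ∨̇ ψ) = rename σ φ ∨̇ rename σ ψ
rename σ (φ ⇒̇ ψ) = rename σ φ ⇒̇ rename σ ψ
rename σ (∀̇ φ)   = ∀̇ (rename (ext σ) φ)
rename σ (∃̇ φ)   = ∃̇ (rename (ext σ) φ)

↑ : Fm → Fm
↑ = rename suc

sub : ℕ → ℕ → ℕ
sub x zero    = x
sub x (suc n) = n

_[_] : Fm → ℕ → Fm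
φ [ x ] = rename (sub x) φ

¬̇_ : Fm → Fm
¬̇ φ = φ ⇒̇ ⊥̇

_⇔̇_ : Fm → Fm → Fm
φ ⇔̇ ψ = (φ ⇒̇ ψ) ∧̇ (ψ ⇒̇ φ)

-- Bounded quantifiers: ∀x∈a φ  and  ∃x∈a φ ; in φ the bound x is index 0,
-- and a is a variable of the outer context.
∀∈ : ℕ → Fm → Fm
∀∈ a φ = ∀̇ (0 ∈̇ suc a ⇒̇ φ)

∃∈ : ℕ → Fm → Fm
∃∈ a φ = ∃̇ (0 ∈̇ suc a ∧̇ φ)

data Δ₀ : Fm → Set where
  mem  : ∀ x y → Δ₀ (x ∈̇ y)
  eq   : ∀ x y → Δ₀ (x ≐ y)
  bot  : Δ₀ ⊥̇
  and  : ∀ {φ ψ} → Δ₀ φ → Δ₀ ψ → Δ₀ (φ ∧̇ ψ)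
  or   : ∀ {φ ψ} → Δ₀ φ → Δ₀ ψ → Δ₀ (φ ∨̇ ψ)
  imp  : ∀ {φ ψ} → Δ₀ φ → Δ₀ ψ → Δ₀ (φ ⇒̇ ψ)
  ball : ∀ {φ} a → Δ₀ φ → Δ₀ (∀∈ a φ)
  bex  : ∀ {φ} a → Δ₀ φ → Δ₀ (∃∈ a φ)

isEmpty : ℕ → Fm
isEmpty e = ∀∈ e ⊥̇

subset : ℕ → ℕ → Fm
subset a b = ∀∈ a (0 ∈̇ suc b)

isSucc : ℕ → ℕ → Fm                   -- s = u ∪ {u}
isSucc s u = ∀∈ s (0 ∈̇ suc u ∨̇ 0 ≐ suc u) ∧̇ (∀∈ u (0 ∈̇ suc s) ∧̇ u ∈̇ s)

Ind : ℕ → Fm                          -- 0 ∈ x  and  x closed under u ↦ u ∪ {u}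
Ind x = ∃∈ x (isEmpty 0) ∧̇ ∀∈ x (∃∈ (suc x) (isSucc 0 1))

isSingleton : ℕ → ℕ → Fm
isSingleton w x = ∀∈ w (0 ≐ suc x) ∧̇ x ∈̇ w

isDoubleton : ℕ → ℕ → ℕ → Fm
isDoubleton w x y = ∀∈ w (0 ≐ suc x ∨̇ 0 ≐ suc y) ∧̇ (x ∈̇ w ∧̇ y ∈̇ w)

isPair : ℕ → ℕ → ℕ → Fm               -- p = ⟨x, y⟩ = {{x}, {x, y}} (Kuratowski)
isPair p x y =
  ∀∈ p (isSingleton 0 (suc x) ∨̇ isDoubleton 0 (suc x) (suc y))
  ∧̇ (∃∈ p (isSingleton 0 (suc x)) ∧̇ ∃∈ p (isDoubleton 0 (suc x) (suc y)))

pairIn : ℕ → ℕ → ℕ → Fm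
pairIn x y f = ∃∈ f (isPair 0 (suc x) (suc y))

Fun : ℕ → Fm
Fun f = ∀∈ f (∃̇ (∃̇ (isPair 2 1 0)))
        ∧̇ ∀̇ (∀̇ (∀̇ (pairIn 2 1 (3 + f) ∧̇ pairIn 2 0 (3 + f) ⇒̇ 1 ≐ 0)))

Dom : ℕ → ℕ → Fm
Dom f a = ∀∈ a (∃̇ (pairIn 1 0 (2 + f)))
          ∧̇ ∀̇ (∀̇ (pairIn 1 0 (2 + f) ⇒̇ 1 ∈̇ (2 + a)))

-- Axioms of IKP + AC_Set.  Schemata may contain arbitrary free variables (parameters).
data IKP+AC : Fm → Set where
  extensionality : IKP+AC (∀̇ (∀̇ (∀̇ (0 ∈̇ 2 ⇔̇ 0 ∈̇ 1) ⇒̇ 1 ≐ 0)))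
  pair           : IKP+AC (∀̇ (∀̇ (∃̇ (2 ∈̇ 0 ∧̇ 1 ∈̇ 0))))
  union          : IKP+AC (∀̇ (∃̇ (∀∈ 1 (∀∈ 0 (0 ∈̇ 2)))))
  infinity       : IKP+AC (∃̇ (Ind 0 ∧̇ ∀̇ (Ind 0 ⇒̇ subset 1 0)))
  -- ∃x ∀u [u ∈ x ↔ (u ∈ a ∧ φ(u))];  in φ index 0 is u, index (suc n) is outer variable n
  Δ₀-separation  : ∀ φ a → Δ₀ φ →
    IKP+AC (∃̇ (∀̇ (0 ∈̇ 1 ⇔̇ (0 ∈̇ suc (suc a) ∧̇ rename (ext suc) φ))))
  -- ∀x∈a ∃y ψ(x,y) → ∃z ∀x∈a ∃y∈z ψ(x,y);  in ψ: 0 = y, 1 = x, (2+n) = outer n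
  Δ₀-collection  : ∀ ψ a → Δ₀ ψ →
    IKP+AC (∀∈ a (∃̇ ψ) ⇒̇ ∃̇ (∀∈ (suc a) (∃∈ 1 (rename (ext (ext suc)) ψ))))
  -- ∀a (∀x∈a φ(x) → φ(a)) → ∀a φ(a);  in φ: 0 = the variable, (suc n) = outer n
  set-induction  : ∀ φ →
    IKP+AC (∀̇ (∀∈ 0 (rename (ext suc) φ) ⇒̇ φ) ⇒̇ ∀̇ φ)
  -- ∀x∈a ∃y ψ(x,y) → ∃f [Fun f ∧ dom f = a ∧ ∀x∈a ψ(x, f(x))];  ψ as for collection
  AC-Set         : ∀ ψ a →
    IKP+AC (∀∈ a (∃̇ ψ) ⇒̇
            ∃̇ (Fun 0 ∧̇ Dom 0 (suc a) ∧̇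
                ∀∈ (suc a) (∃̇ (pairIn 1 0 2 ∧̇ rename (ext (ext suc)) ψ))))

data _⊢_ (Γ : List Fm) : Fm → Set where
  hyp   : ∀ {φ} → φ ∈ Γ → Γ ⊢ φ
  ax    : ∀ {φ} → IKP+AC φ → Γ ⊢ φ
  ⊥E    : ∀ {φ} → Γ ⊢ ⊥̇ → Γ ⊢ φ
  ∧I    : ∀ {φ ψ} → Γ ⊢ φ → Γ ⊢ ψ → Γ ⊢ φ ∧̇ ψ
  ∧E₁   : ∀ {φ ψ} → Γ ⊢ φ ∧̇ ψ → Γ ⊢ φ
  ∧E₂   : ∀ {φ ψ} → Γ ⊢ φ ∧̇ ψ → Γ ⊢ ψ
  ∨I₁   : ∀ {φ ψ} → Γ ⊢ φ → Γ ⊢ φ ∨̇ ψ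
  ∨I₂   : ∀ {φ ψ} → Γ ⊢ ψ → Γ ⊢ φ ∨̇ ψ
  ∨E    : ∀ {φ ψ χ} → Γ ⊢ φ ∨̇ ψ → φ ∷ Γ ⊢ χ → ψ ∷ Γ ⊢ χ → Γ ⊢ χ
  ⇒I    : ∀ {φ ψ} → φ ∷ Γ ⊢ ψ → Γ ⊢ φ ⇒̇ ψ
  ⇒E    : ∀ {φ ψ} → Γ ⊢ φ ⇒̇ ψ → Γ ⊢ φ → Γ ⊢ ψ
  ∀I    : ∀ {φ} → map ↑ Γ ⊢ φ → Γ ⊢ ∀̇ φ
  ∀E    : ∀ {φ} x → Γ ⊢ ∀̇ φ → Γ ⊢ φ [ x ]
  ∃I    : ∀ {φ} x → Γ ⊢ φ [ x ] → Γ ⊢ ∃̇ φ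
  ∃E    : ∀ {φ ψ} → Γ ⊢ ∃̇ φ → φ ∷ map ↑ Γ ⊢ ↑ ψ → Γ ⊢ ψ
  ≐refl : ∀ x → Γ ⊢ x ≐ x
  ≐subst : ∀ {φ} x y → Γ ⊢ x ≐ y → Γ ⊢ φ [ x ] → Γ ⊢ φ [ y ]

Δ₀-LEM : Fm → Fm
Δ₀-LEM φ = φ ∨̇ ¬̇ φ

-- BOS: ∀x∈a [φ(x) ∨ ¬φ(x)] → [∀x∈a φ(x) ∨ ∃x∈a ¬φ(x)]; in φ: 0 = x, (suc n) = outer n
BOS : Fm → ℕ → Fm
BOS φ a = ∀∈ a (φ ∨̇ ¬̇ φ) ⇒̇ (∀∈ a φ ∨̇ ∃∈ a (¬̇ φ))

module Submission where

open import Defs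
open import Data.Nat using (ℕ; zero; suc; _+_)
open import Data.List using ([]; _∷_; map)
open import Data.List.Properties using (map-∘; map-cong)
open import Data.List.Membership.Propositional.Properties using (∈-map⁺)
open import Data.List.Relation.Unary.Any using (here)
open import Data.List.Relation.Binary.Subset.Propositional using (_⊆_)
open import Data.List.Relation.Binary.Subset.Propositional.Properties using (map⁺; ∷⁺ʳ; xs⊆x∷xs)
open import Data.Product using (_×_; _,_)
open import Function using (_∘_)
open import Relation.Binary.PropositionalEquality using (_≡_; refl; sym; trans; cong; cong₂; subst)

Agree : (ℕ → ℕ) → (ℕ → ℕ) → Set
Agree σ τ = ∀ n → σ n ≡ τ n

ext-cong : ∀ {σ τ} → Agree σ τ → Agree (ext σ) (ext τ)
ext-cong e zero    = refl
ext-cong e (suc n) = cong suc (e n)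

rename-cong : ∀ {σ τ} → Agree σ τ → ∀ φ → rename σ φ ≡ rename τ φ
rename-cong e (x ∈̇ y) = cong₂ _∈̇_ (e x) (e y)
rename-cong e (x ≐ y) = cong₂ _≐_ (e x) (e y)
rename-cong e ⊥̇       = refl
rename-cong e (φ ∧̇ ψ) = cong₂ _∧̇_ (rename-cong e φ) (rename-cong e ψ)
rename-cong e (φ ∨̇ ψ) = cong₂ _∨̇_ (rename-cong e φ) (rename-cong e ψ)
rename-cong e (φ ⇒̇ ψ) = cong₂ _⇒̇_ (rename-cong e φ) (rename-cong e ψ)
rename-cong e (∀̇ φ)   = cong ∀̇ (rename-cong (ext-cong e) φ)
rename-cong e (∃̇ φ)   = cong ∃̇ (rename-cong (ext-cong e) φ)

ext-id : ∀ {σ} → Agree σ (λ n → n) → Agree (ext σ) (λ n → n)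
ext-id e zero    = refl
ext-id e (suc n) = cong suc (e n)

rename-id : ∀ {σ} → Agree σ (λ n → n) → ∀ φ → rename σ φ ≡ φ
rename-id e (x ∈̇ y) = cong₂ _∈̇_ (e x) (e y)
rename-id e (x ≐ y) = cong₂ _≐_ (e x) (e y)
rename-id e ⊥̇       = refl
rename-id e (φ ∧̇ ψ) = cong₂ _∧̇_ (rename-id e φ) (rename-id e ψ)
rename-id e (φ ∨̇ ψ) = cong₂ _∨̇_ (rename-id e φ) (rename-id e ψ)
rename-id e (φ ⇒̇ ψ) = cong₂ _⇒̇_ (rename-id e φ) (rename-id e ψ)
rename-id e (∀̇ φ)   = cong ∀̇ (rename-id (ext-id e) φ)
rename-id e (∃̇ φ)   = cong ∃̇ (rename-id (ext-id e) φ)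

ext-∘ : ∀ σ τ → Agree (ext σ ∘ ext τ) (ext (σ ∘ τ))
ext-∘ σ τ zero    = refl
ext-∘ σ τ (suc n) = refl

rename-∘ : ∀ σ τ φ → rename σ (rename τ φ) ≡ rename (σ ∘ τ) φ
rename-∘ σ τ (x ∈̇ y) = refl
rename-∘ σ τ (x ≐ y) = refl
rename-∘ σ τ ⊥̇       = refl
rename-∘ σ τ (φ ∧̇ ψ) = cong₂ _∧̇_ (rename-∘ σ τ φ) (rename-∘ σ τ ψ)
rename-∘ σ τ (φ ∨̇ ψ) = cong₂ _∨̇_ (rename-∘ σ τ φ) (rename-∘ σ τ ψ)
rename-∘ σ τ (φ ⇒̇ ψ) = cong₂ _⇒̇_ (rename-∘ σ τ φ) (rename-∘ σ τ ψ)
rename-∘ σ τ (∀̇ φ)   = cong ∀̇ (trans (rename-∘ (ext σ) (ext τ) φ) (rename-cong (ext-∘ σ τ) φ))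
rename-∘ σ τ (∃̇ φ)   = cong ∃̇ (trans (rename-∘ (ext σ) (ext τ) φ) (rename-cong (ext-∘ σ τ) φ))

rename-square : ∀ {σ τ σ' τ'} → Agree (σ ∘ τ) (σ' ∘ τ') →
                ∀ φ → rename σ (rename τ φ) ≡ rename σ' (rename τ' φ)
rename-square {σ} {τ} {σ'} {τ'} e φ =
  trans (rename-∘ σ τ φ) (trans (rename-cong e φ) (sym (rename-∘ σ' τ' φ)))

↑-rename : ∀ ρ φ → rename (ext ρ) (↑ φ) ≡ ↑ (rename ρ φ)
↑-rename ρ = rename-square (λ _ → refl)

rename-commute₁ : ∀ ρ φ → rename (ext (ext ρ)) (rename (ext suc) φ) ≡ rename (ext suc) (rename (ext ρ) φ)
rename-commute₁ ρ = rename-square λ { zero → refl ; (suc n) → refl }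

rename-commute₂ : ∀ ρ φ → rename (ext (ext (ext ρ))) (rename (ext (ext suc)) φ)
                          ≡ rename (ext (ext suc)) (rename (ext (ext ρ)) φ)
rename-commute₂ ρ = rename-square λ { zero → refl ; (suc zero) → refl ; (suc (suc n)) → refl }

sub-rename : ∀ ρ x φ → rename ρ (φ [ x ]) ≡ (rename (ext ρ) φ) [ ρ x ]
sub-rename ρ x = rename-square λ { zero → refl ; (suc n) → refl }

sub-↑ : ∀ x φ → (↑ φ) [ x ] ≡ φ
sub-↑ x φ = trans (rename-∘ (sub x) suc φ) (rename-id (λ _ → refl) φ)

sub-ext-suc : ∀ φ → (rename (ext suc) φ) [ 0 ] ≡ φ
sub-ext-suc φ = trans (rename-∘ (sub 0) (ext suc) φ) (rename-id (λ { zero → refl ; (suc n) → refl }) φ)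

Δ₀-rename : ∀ σ {φ} → Δ₀ φ → Δ₀ (rename σ φ)
Δ₀-rename σ (mem x y)  = mem (σ x) (σ y)
Δ₀-rename σ (eq x y)   = eq (σ x) (σ y)
Δ₀-rename σ bot        = bot
Δ₀-rename σ (and d e)  = and (Δ₀-rename σ d) (Δ₀-rename σ e)
Δ₀-rename σ (or d e)   = or (Δ₀-rename σ d) (Δ₀-rename σ e)
Δ₀-rename σ (imp d e)  = imp (Δ₀-rename σ d) (Δ₀-rename σ e)
Δ₀-rename σ (ball a d) = ball (σ a) (Δ₀-rename (ext σ) d)
Δ₀-rename σ (bex a d)  = bex (σ a) (Δ₀-rename (ext σ) d)

Δ₀-pairIn : ∀ x y f → Δ₀ (pairIn x y f)
Δ₀-pairIn x y f = bex f (and (ball 0 (or (singleton 0 (2 + x)) (doubleton 0 (2 + x) (2 + y))))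
                             (and (bex 0 (singleton 0 (2 + x))) (bex 0 (doubleton 0 (2 + x) (2 + y)))))
  where
  singleton : ∀ w u → Δ₀ (isSingleton w u)
  singleton w u = and (ball w (eq 0 (suc u))) (mem u w)
  doubleton : ∀ w u v → Δ₀ (isDoubleton w u v)
  doubleton w u v = and (ball w (or (eq 0 (suc u)) (eq 0 (suc v)))) (and (mem u w) (mem v w))

conv : ∀ {Γ φ ψ} → φ ≡ ψ → Γ ⊢ φ → Γ ⊢ ψ
conv refl d = d

conv-ctx : ∀ {Γ Δ φ} → Γ ≡ Δ → Γ ⊢ φ → Δ ⊢ φ
conv-ctx refl d = d

-- The axioms are closed under renaming: the schemata are instantiated at the
-- renamed formula, the remaining axioms are sentences.
rename-axiom : ∀ ρ {φ} → IKP+AC φ → IKP+AC (rename ρ φ)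
rename-axiom ρ extensionality = extensionality
rename-axiom ρ pair           = pair
rename-axiom ρ union          = union
rename-axiom ρ infinity       = infinity
rename-axiom ρ (Δ₀-separation φ a d) =
  subst IKP+AC (cong (λ χ → ∃̇ (∀̇ (0 ∈̇ 1 ⇔̇ (0 ∈̇ suc (suc (ρ a)) ∧̇ χ)))) (sym (rename-commute₁ ρ φ)))
        (Δ₀-separation (rename (ext ρ) φ) (ρ a) (Δ₀-rename (ext ρ) d))
rename-axiom ρ (Δ₀-collection ψ a d) =
  subst IKP+AC (cong (λ χ → ∀∈ (ρ a) (∃̇ (rename (ext (ext ρ)) ψ)) ⇒̇ ∃̇ (∀∈ (suc (ρ a)) (∃∈ 1 χ)))
                     (sym (rename-commute₂ ρ ψ)))
        (Δ₀-collection (rename (ext (ext ρ)) ψ) (ρ a) (Δ₀-rename (ext (ext ρ)) d))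
rename-axiom ρ (set-induction φ) =
  subst IKP+AC (cong (λ χ → ∀̇ (∀∈ 0 χ ⇒̇ rename (ext ρ) φ) ⇒̇ ∀̇ (rename (ext ρ) φ)) (sym (rename-commute₁ ρ φ)))
        (set-induction (rename (ext ρ) φ))
rename-axiom ρ (AC-Set ψ a) =
  subst IKP+AC (cong (λ χ → ∀∈ (ρ a) (∃̇ (rename (ext (ext ρ)) ψ)) ⇒̇
                          ∃̇ (Fun 0 ∧̇ Dom 0 (suc (ρ a)) ∧̇ ∀∈ (suc (ρ a)) (∃̇ (pairIn 1 0 2 ∧̇ χ))))
                     (sym (rename-commute₂ ρ ψ)))
        (AC-Set (rename (ext (ext ρ)) ψ) (ρ a))

map-↑-rename : ∀ ρ Γ → map (rename (ext ρ)) (map ↑ Γ) ≡ map ↑ (map (rename ρ) Γ)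
map-↑-rename ρ Γ = trans (sym (map-∘ Γ)) (trans (map-cong (↑-rename ρ) Γ) (map-∘ Γ))

rename-⊢ : ∀ ρ {Γ φ} → Γ ⊢ φ → map (rename ρ) Γ ⊢ rename ρ φ
rename-⊢ ρ (hyp p)    = hyp (∈-map⁺ (rename ρ) p)
rename-⊢ ρ (ax a)     = ax (rename-axiom ρ a)
rename-⊢ ρ (⊥E d)     = ⊥E (rename-⊢ ρ d)
rename-⊢ ρ (∧I d e)   = ∧I (rename-⊢ ρ d) (rename-⊢ ρ e)
rename-⊢ ρ (∧E₁ d)    = ∧E₁ (rename-⊢ ρ d)
rename-⊢ ρ (∧E₂ d)    = ∧E₂ (rename-⊢ ρ d)
rename-⊢ ρ (∨I₁ d)    = ∨I₁ (rename-⊢ ρ d)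
rename-⊢ ρ (∨I₂ d)    = ∨I₂ (rename-⊢ ρ d)
rename-⊢ ρ (∨E d e f) = ∨E (rename-⊢ ρ d) (rename-⊢ ρ e) (rename-⊢ ρ f)
rename-⊢ ρ (⇒I d)     = ⇒I (rename-⊢ ρ d)
rename-⊢ ρ (⇒E d e)   = ⇒E (rename-⊢ ρ d) (rename-⊢ ρ e)
rename-⊢ ρ {Γ} (∀I d) = ∀I (conv-ctx (map-↑-rename ρ Γ) (rename-⊢ (ext ρ) d))
rename-⊢ ρ (∀E {φ} x d) = conv (sym (sub-rename ρ x φ)) (∀E (ρ x) (rename-⊢ ρ d))
rename-⊢ ρ (∃I {φ} x d) = ∃I (ρ x) (conv (sub-rename ρ x φ) (rename-⊢ ρ d))
rename-⊢ ρ {Γ} (∃E {ψ = ψ} d e) =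
  ∃E (rename-⊢ ρ d)
     (conv-ctx (cong (_ ∷_) (map-↑-rename ρ Γ)) (conv (↑-rename ρ ψ) (rename-⊢ (ext ρ) e)))
rename-⊢ ρ (≐refl x)  = ≐refl (ρ x)
rename-⊢ ρ (≐subst {φ} x y d e) =
  conv (sym (sub-rename ρ y φ))
       (≐subst (ρ x) (ρ y) (rename-⊢ ρ d) (conv (sub-rename ρ x φ) (rename-⊢ ρ e)))

weaken : ∀ {Γ Δ φ} → Γ ⊆ Δ → Γ ⊢ φ → Δ ⊢ φ
weaken s (hyp p)          = hyp (s p)
weaken s (ax a)           = ax a
weaken s (⊥E d)           = ⊥E (weaken s d)
weaken s (∧I d e)         = ∧I (weaken s d) (weaken s e)
weaken s (∧E₁ d)          = ∧E₁ (weaken s d)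
weaken s (∧E₂ d)          = ∧E₂ (weaken s d)
weaken s (∨I₁ d)          = ∨I₁ (weaken s d)
weaken s (∨I₂ d)          = ∨I₂ (weaken s d)
weaken s (∨E d e f)       = ∨E (weaken s d) (weaken (∷⁺ʳ _ s) e) (weaken (∷⁺ʳ _ s) f)
weaken s (⇒I d)           = ⇒I (weaken (∷⁺ʳ _ s) d)
weaken s (⇒E d e)         = ⇒E (weaken s d) (weaken s e)
weaken s (∀I d)           = ∀I (weaken (map⁺ ↑ s) d)
weaken s (∀E x d)         = ∀E x (weaken s d)
weaken s (∃I x d)         = ∃I x (weaken s d)
weaken s (∃E d e)         = ∃E (weaken s d) (weaken (∷⁺ʳ _ (map⁺ ↑ s)) e)
weaken s (≐refl x)        = ≐refl x
weaken s (≐subst x y d e) = ≐subst x y (weaken s d) (weaken s e)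

new : ∀ {Γ φ} → φ ∷ Γ ⊢ φ
new = hyp (here refl)

wk : ∀ {Γ φ ψ} → Γ ⊢ ψ → φ ∷ Γ ⊢ ψ
wk = weaken (xs⊆x∷xs _ _)

shift : ∀ {Γ φ} → Γ ⊢ φ → map ↑ Γ ⊢ ↑ φ
shift = rename-⊢ suc

-- Transport a derivation into the scope of a new variable and hypothesis,
-- as opened by ∃E or by ∀I followed by ⇒I.
lift : ∀ {Γ φ ψ} → Γ ⊢ ψ → φ ∷ map ↑ Γ ⊢ ↑ ψ
lift d = wk (shift d)

⇔E₁ : ∀ {Γ φ ψ} → Γ ⊢ φ ⇔̇ ψ → Γ ⊢ φ → Γ ⊢ ψ
⇔E₁ d = ⇒E (∧E₁ d)

⇔E₂ : ∀ {Γ φ ψ} → Γ ⊢ φ ⇔̇ ψ → Γ ⊢ ψ → Γ ⊢ φ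
⇔E₂ d = ⇒E (∧E₂ d)

≐-sym : ∀ {Γ x y} → Γ ⊢ x ≐ y → Γ ⊢ y ≐ x
≐-sym {x = x} {y} d = ≐subst {φ = 0 ≐ suc x} x y d (≐refl x)

≐-trans : ∀ {Γ x y z} → Γ ⊢ x ≐ y → Γ ⊢ y ≐ z → Γ ⊢ x ≐ z
≐-trans {x = x} {y} {z} d e = ≐subst {φ = suc x ≐ 0} y z e d

∈-substʳ : ∀ {Γ z x y} → Γ ⊢ z ∈̇ x → Γ ⊢ x ≐ y → Γ ⊢ z ∈̇ y
∈-substʳ {z = z} {x} {y} d e = ≐subst {φ = suc z ∈̇ 0} x y e d

pairIn-substˡ : ∀ {Γ x x' y f} → Γ ⊢ pairIn x y f → Γ ⊢ x ≐ x' → Γ ⊢ pairIn x' y f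
pairIn-substˡ {x = x} {x'} {y} {f} d e = ≐subst {φ = pairIn 0 (suc y) (suc f)} x x' e d

pairIn-substʳ : ∀ {Γ x y y' f} → Γ ⊢ pairIn x y f → Γ ⊢ y ≐ y' → Γ ⊢ pairIn x y' f
pairIn-substʳ {x = x} {y} {y'} {f} d e = ≐subst {φ = pairIn (suc x) 0 (suc f)} y y' e d

∀∈I : ∀ {Γ a φ} → 0 ∈̇ suc a ∷ map ↑ Γ ⊢ φ → Γ ⊢ ∀∈ a φ
∀∈I d = ∀I (⇒I d)

∀∈E : ∀ {Γ a φ x} → Γ ⊢ ∀∈ a φ → Γ ⊢ x ∈̇ a → Γ ⊢ φ [ x ]
∀∈E {x = x} d m = ⇒E (∀E x d) m

empty-distinct : ∀ {Γ e w} → Γ ⊢ isEmpty e → Γ ⊢ e ∈̇ w → Γ ⊢ ¬̇ (e ≐ w)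
empty-distinct empty e∈w = ⇒I (∀∈E (wk empty) (∈-substʳ (wk e∈w) (≐-sym new)))

fun-unique : ∀ {Γ f x y y'} → Γ ⊢ Fun f → Γ ⊢ pairIn x y f → Γ ⊢ pairIn x y' f → Γ ⊢ y ≐ y'
fun-unique {x = x} {y} {y'} F p q = ⇒E (∀E y' (∀E y (∀E x (∧E₂ F)))) (∧I p q)

extensional : ∀ {Γ a b} → Γ ⊢ ∀̇ (0 ∈̇ suc a ⇔̇ 0 ∈̇ suc b) → Γ ⊢ a ≐ b
extensional {a = a} {b} d = ⇒E (∀E b (∀E a (ax extensionality))) d

pairing : ∀ {Γ} a b → Γ ⊢ ∃̇ (suc a ∈̇ 0 ∧̇ suc b ∈̇ 0)
pairing a b = ∀E b (∀E a (ax pair))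

-- s = {u ∈ a | χ(u)}; in χ the variable u is 0 and the parameter n is suc n.
IsSep : ℕ → ℕ → Fm → Fm
IsSep s a χ = ∀̇ (0 ∈̇ suc s ⇔̇ (0 ∈̇ suc a ∧̇ χ))

separation : ∀ {Γ} a χ → Δ₀ χ → Γ ⊢ ∃̇ (IsSep 0 (suc a) (rename (ext suc) χ))
separation a χ d = ax (Δ₀-separation χ a d)

sep-elim : ∀ {Γ s a χ t} → Γ ⊢ IsSep s a χ → Γ ⊢ t ∈̇ s → Γ ⊢ t ∈̇ a ∧̇ χ [ t ]
sep-elim {t = t} S m = ⇔E₁ (∀E t S) m

sep-intro : ∀ {Γ s a χ t} → Γ ⊢ IsSep s a χ → Γ ⊢ t ∈̇ a → Γ ⊢ χ [ t ] → Γ ⊢ t ∈̇ s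
sep-intro {t = t} S m c = ⇔E₂ (∀E t S) (∧I m c)

separations-equal : ∀ {Γ A B t χ χ'} → Γ ⊢ IsSep A t χ → Γ ⊢ IsSep B t χ' →
                    Γ ⊢ ∀̇ χ → Γ ⊢ ∀̇ χ' → Γ ⊢ A ≐ B
separations-equal sA sB all-χ all-χ' =
  extensional (∀I (∧I (⇒I (sep-intro (lift sB) (∧E₁ (sep-elim (lift sA) new)) (∀E 0 (lift all-χ'))))
                      (⇒I (sep-intro (lift sA) (∧E₁ (sep-elim (lift sB) new)) (∀E 0 (lift all-χ))))))

-- There are sets e and w with e empty and e ∈ w: e = {u ∈ x₀ | ⊥} for any
-- set x₀, and w is obtained by pairing.
zero-and-one : ∀ {Γ} → Γ ⊢ ∃̇ (∃̇ (isEmpty 1 ∧̇ 1 ∈̇ 0))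
zero-and-one =
  ∃E (separation 0 ⊥̇ bot)
     (∃E (pairing 0 0)
         (∃I 1 (∃I 0 (∧I (∀∈I (∧E₂ (sep-elim (lift (lift new)) new))) (∧E₁ new)))))

-- The exact pair {a, b} = {u ∈ p | u = a ∨ u = b} for a set p ∋ a, b.
doubleton : ∀ {Γ} a b → Γ ⊢ ∃̇ (isDoubleton 0 (suc a) (suc b))
doubleton a b =
  ∃E (pairing a b)
     (∃E (separation 0 (0 ≐ (2 + a) ∨̇ 0 ≐ (2 + b)) (or (eq 0 _) (eq 0 _)))
         (∃I 0 (∧I (∀∈I (∧E₂ (sep-elim (lift new) new)))
                   (∧I (sep-intro new (∧E₁ (lift new)) (∨I₁ (≐refl _)))
                       (sep-intro new (∧E₂ (lift new)) (∨I₂ (≐refl _)))))))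

doubleton-inhabited : ∀ {Γ d A B a₀ b₀} → Γ ⊢ isDoubleton d A B →
                      Γ ⊢ a₀ ∈̇ A → Γ ⊢ b₀ ∈̇ B → Γ ⊢ ∀∈ d (∃̇ (0 ∈̇ 1))
doubleton-inhabited D a₀∈A b₀∈B =
  ∀∈I (∨E (∀∈E (lift (∧E₁ D)) new)
          (∃I _ (∈-substʳ (wk (lift a₀∈A)) (≐-sym new)))
          (∃I _ (∈-substʳ (wk (lift b₀∈B)) (≐-sym new))))

-- AC_Set on {A, B} yields a ∈ A and b ∈ B chosen by one function, so that
-- A = B forces a = b.
choice-on-pair : ∀ {Γ A B a₀ b₀} → Γ ⊢ a₀ ∈̇ A → Γ ⊢ b₀ ∈̇ B →
                 Γ ⊢ ∃̇ (∃̇ (1 ∈̇ (2 + A) ∧̇ 0 ∈̇ (2 + B) ∧̇ ((2 + A) ≐ (2 + B) ⇒̇ 1 ≐ 0)))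
choice-on-pair {A = A} {B} a₀∈A b₀∈B =
  ∃E (doubleton A B)
     -- d = {A, B};  f with f(X) ∈ X for X ∈ d
     (∃E (⇒E (ax (AC-Set (0 ∈̇ 1) 0)) (doubleton-inhabited new (lift a₀∈A) (lift b₀∈B)))
         -- a = f(A)
         (∃E (∀∈E (∧E₂ (∧E₂ new)) (∧E₁ (∧E₂ (lift new))))
             -- b = f(B)
             (∃E (∀∈E (∧E₂ (∧E₂ (lift new))) (∧E₂ (∧E₂ (lift (lift new)))))
                 (∃I 1 (∃I 0 (∧I (∧E₂ (lift new)) (∧I (∧E₂ new)
                   (⇒I (fun-unique (wk (∧E₁ (lift (lift new))))
                                   (wk (∧E₁ (lift new)))
                                   (pairIn-substˡ (wk (∧E₁ new)) (≐-sym new)))))))))))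

EqOrMem : ℕ → ℕ → ℕ → Fm
EqOrMem c x y = 0 ≐ suc c ∨̇ suc x ∈̇ suc y

-- If x ∈ y, then A = {u ∈ t | u = e ∨ x ∈ y} and B = {u ∈ t | u = w ∨ x ∈ y}
-- are both t, so the choices a = e and b = w would coincide.
refute-membership : ∀ {Γ e w t A B a b x y} → Γ ⊢ ¬̇ (e ≐ w) →
                    Γ ⊢ IsSep A t (EqOrMem e x y) → Γ ⊢ IsSep B t (EqOrMem w x y) →
                    Γ ⊢ A ≐ B ⇒̇ a ≐ b → Γ ⊢ a ≐ e → Γ ⊢ b ≐ w → Γ ⊢ ¬̇ (x ∈̇ y)
refute-membership {Γ} {A = A} {B} {x = x} {y} e≢w sA sB respects a≐e b≐w =
  ⇒I (⇒E (wk e≢w) (≐-trans (≐-sym (wk a≐e)) (≐-trans (⇒E (wk respects) A≐B) (wk b≐w))))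
  where
  A≐B : x ∈̇ y ∷ Γ ⊢ A ≐ B
  A≐B = separations-equal (wk sA) (wk sB) (∀I (∨I₂ (shift new))) (∀I (∨I₂ (shift new)))

decide-by-choice : ∀ {Γ e w t A B a b x y} → Γ ⊢ ¬̇ (e ≐ w) →
                   Γ ⊢ IsSep A t (EqOrMem e x y) → Γ ⊢ IsSep B t (EqOrMem w x y) →
                   Γ ⊢ a ∈̇ A → Γ ⊢ b ∈̇ B → Γ ⊢ A ≐ B ⇒̇ a ≐ b → Γ ⊢ x ∈̇ y ∨̇ ¬̇ (x ∈̇ y)
decide-by-choice e≢w sA sB a∈A b∈B respects =
  ∨E (∧E₂ (sep-elim sA a∈A))
     (∨E (wk (∧E₂ (sep-elim sB b∈B)))
         (∨I₂ (refute-membership (wk (wk e≢w)) (wk (wk sA)) (wk (wk sB)) (wk (wk respects))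
                                 (wk new) new))
         (∨I₁ new))
     (∨I₁ new)

decide-by-separations : ∀ {Γ e w t A B x y} → Γ ⊢ ¬̇ (e ≐ w) → Γ ⊢ e ∈̇ t → Γ ⊢ w ∈̇ t →
                        Γ ⊢ IsSep A t (EqOrMem e x y) → Γ ⊢ IsSep B t (EqOrMem w x y) →
                        Γ ⊢ x ∈̇ y ∨̇ ¬̇ (x ∈̇ y)
decide-by-separations e≢w e∈t w∈t sA sB =
  ∃E (choice-on-pair (sep-intro sA e∈t (∨I₁ (≐refl _))) (sep-intro sB w∈t (∨I₁ (≐refl _))))
     (∃E new (decide-by-choice (lift (lift e≢w)) (lift (lift sA)) (lift (lift sB))
                               (∧E₁ new) (∧E₁ (∧E₂ new)) (∧E₂ (∧E₂ new))))

diaconescu : ∀ {Γ e w} x y → Γ ⊢ ¬̇ (e ≐ w) → Γ ⊢ x ∈̇ y ∨̇ ¬̇ (x ∈̇ y)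
diaconescu {e = e} {w} x y e≢w =
  -- t ∋ e, w
  ∃E (pairing e w)
     -- A = {u ∈ t | u = e ∨ x ∈ y}
     (∃E (separation 0 (EqOrMem (suc e) (suc x) (suc y)) (or (eq 0 _) (mem _ _)))
         -- B = {u ∈ t | u = w ∨ x ∈ y}
         (∃E (separation 1 (EqOrMem (2 + w) (2 + x) (2 + y)) (or (eq 0 _) (mem _ _)))
             (decide-by-separations (lift (lift (lift e≢w)))
                                    (∧E₁ (lift (lift new))) (∧E₂ (lift (lift new)))
                                    (lift new) new)))

membership-decidable : ∀ {Γ} x y → Γ ⊢ x ∈̇ y ∨̇ ¬̇ (x ∈̇ y)
membership-decidable x y =
  ∃E zero-and-one (∃E new (diaconescu (2 + x) (2 + y) (empty-distinct (∧E₁ new) (∧E₂ new))))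

-- Δ₀-LEM: a Δ₀ formula φ is equivalent to the membership x₀ ∈ {u ∈ p | φ},
-- where x₀ is the variable 0 and p is a set containing it.
Δ₀-decidable : ∀ {Γ} φ → Δ₀ φ → Γ ⊢ φ ∨̇ ¬̇ φ
Δ₀-decidable φ d =
  ∃E (pairing 0 0)
     (∃E (separation 0 (↑ (↑ φ)) (Δ₀-rename suc (Δ₀-rename suc d)))
         (∨E (membership-decidable 2 0)
             (∨I₁ (conv condition (∧E₂ (sep-elim (wk new) new))))
             (∨I₂ (⇒I (⇒E (wk new) (sep-intro (wk (wk new)) (∧E₁ (wk (wk (lift new))))
                                               (conv (sym condition) new)))))))
  where
  condition : (rename (ext suc) (↑ (↑ φ))) [ 2 ] ≡ ↑ (↑ φ)
  condition = trans (cong _[ 2 ] (↑-rename suc (↑ φ))) (sub-↑ 2 (↑ (↑ φ)))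

Selected : ℕ → Fm → ℕ → ℕ → Fm
Selected y P e w = (P ∧̇ y ≐ e) ∨̇ (¬̇ P ∧̇ y ≐ w)

-- f sends each x ∈ a to e if φ(x) and to w if ¬φ(x); in φ the argument x is
-- the variable 0 and the parameter n is suc n.
Characteristic : ℕ → Fm → ℕ → ℕ → ℕ → Fm
Characteristic f φ a e w = ∀∈ a (∃̇ (pairIn 1 0 (2 + f) ∧̇ Selected 0 (↑ φ) (2 + e) (2 + w)))

lift-Selected : ∀ φ e w → rename (ext (ext suc)) (Selected 0 (↑ φ) (2 + e) (2 + w))
                          ≡ Selected 0 (↑ (rename (ext suc) φ)) (3 + e) (3 + w)
lift-Selected φ e w = cong (λ χ → Selected 0 χ (3 + e) (3 + w)) (↑-rename (ext suc) φ)

characteristic-function :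
  ∀ {Γ} φ {a e w} → Γ ⊢ ∀∈ a (φ ∨̇ ¬̇ φ) →
  Γ ⊢ ∃̇ (Fun 0 ∧̇ Dom 0 (suc a) ∧̇ Characteristic 0 (rename (ext suc) φ) (suc a) (suc e) (suc w))
characteristic-function φ {a} {e} {w} decidable =
  ⇒E (conv (cong (λ χ → ∀∈ a (∃̇ ψ) ⇒̇ ∃̇ (Fun 0 ∧̇ Dom 0 (suc a) ∧̇ ∀∈ (suc a) (∃̇ (pairIn 1 0 2 ∧̇ χ))))
                 (lift-Selected φ e w))
           (ax (AC-Set ψ a)))
     (∀∈I (∨E (∀∈E (lift decidable) new)
              (∃I (suc e) (∨I₁ (∧I (conv instance-of-φ new) (≐refl _))))
              (∃I (suc w) (∨I₂ (∧I (conv (cong ¬̇_ instance-of-φ) new) (≐refl _))))))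
  where
  ψ : Fm
  ψ = Selected 0 (↑ φ) (2 + e) (2 + w)
  instance-of-φ : ∀ {y} → (rename (ext suc) φ) [ 0 ] ≡ (↑ φ) [ y ]
  instance-of-φ = trans (sub-ext-suc φ) (sym (sub-↑ _ φ))

↑-Characteristic : ∀ f φ a e w → ↑ (Characteristic f φ a e w)
                                  ≡ Characteristic (suc f) (rename (ext suc) φ) (suc a) (suc e) (suc w)
↑-Characteristic f φ a e w =
  cong (λ χ → ∀∈ (suc a) (∃̇ (pairIn 1 0 (3 + f) ∧̇ χ))) (lift-Selected φ e w)

select-value : ∀ {Γ f φ a e w x} → Γ ⊢ Characteristic f φ a e w → Γ ⊢ x ∈̇ a →
               Γ ⊢ ∃̇ (pairIn (suc x) 0 (suc f) ∧̇ Selected 0 (↑ (φ [ x ])) (suc e) (suc w))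
select-value {φ = φ} {x = x} C x∈a =
  conv (cong (λ χ → ∃̇ (pairIn (suc x) 0 _ ∧̇ Selected 0 χ _ _)) (↑-rename (sub x) φ)) (∀∈E C x∈a)

fails-if-sent-to-w : ∀ {Γ f φ a e w x} → Γ ⊢ ¬̇ (e ≐ w) → Γ ⊢ Fun f →
                     Γ ⊢ Characteristic f φ a e w → Γ ⊢ x ∈̇ a → Γ ⊢ pairIn x w f →
                     Γ ⊢ ¬̇ (φ [ x ])
fails-if-sent-to-w e≢w F C x∈a x↦w =
  ⇒I (∃E (select-value (wk C) (wk x∈a))
         (∨E (∧E₂ new)
             (⇒E (up e≢w) (≐-trans (≐-sym (∧E₂ new)) (fun-unique (up F) (wk (∧E₁ new)) (up x↦w))))
             (⇒E (∧E₁ new) (wk (lift new)))))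
  where
  up : ∀ {Γ χ ψ₁ ψ₂ ψ₃} → Γ ⊢ χ → ψ₃ ∷ ψ₂ ∷ map ↑ (ψ₁ ∷ Γ) ⊢ ↑ χ
  up d = wk (lift (wk d))

holds-if-not-sent-to-w : ∀ {Γ f φ a e w x} → Γ ⊢ Characteristic f φ a e w → Γ ⊢ x ∈̇ a →
                         Γ ⊢ ¬̇ (pairIn x w f) → Γ ⊢ φ [ x ]
holds-if-not-sent-to-w C x∈a x↛w =
  ∃E (select-value C x∈a)
     (∨E (∧E₂ new)
         (∧E₁ new)
         (⊥E (⇒E (wk (lift x↛w)) (pairIn-substʳ (wk (∧E₁ new)) (∧E₂ new)))))

-- The Δ₀ statement "some x ∈ a is sent to w" decides BOS for φ.
decide-by-values : ∀ {Γ f φ a e w} → Γ ⊢ ¬̇ (e ≐ w) → Γ ⊢ Fun f →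
                   Γ ⊢ Characteristic f φ a e w → Γ ⊢ ∀∈ a φ ∨̇ ∃∈ a (¬̇ φ)
decide-by-values {Γ} {f} {φ} {a} {e} {w} e≢w F C =
  ∨E (Δ₀-decidable (∃∈ a (pairIn 0 (suc w) (suc f))) (bex a (Δ₀-pairIn 0 (suc w) (suc f))))
     (∨I₂ (∃E new (∃I 0 (∧I (∧E₁ new)
        (fails-if-sent-to-w (lift (wk e≢w)) (lift (wk F)) lifted-C (∧E₁ new) (∧E₂ new))))))
     (∨I₁ (∀∈I (conv (sub-ext-suc φ)
        (holds-if-not-sent-to-w lifted-C new (⇒I (⇒E (wk (lift new)) (∃I 0 (∧I (wk new) new))))))))
  where
  lifted-C : ∀ {ψ₁ ψ₂} → ψ₂ ∷ map ↑ (ψ₁ ∷ Γ) ⊢ Characteristic (suc f) (rename (ext suc) φ) (suc a) (suc e) (suc w)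
  lifted-C = conv (↑-Characteristic f φ a e w) (lift (wk C))

bounded-omniscience : ∀ {Γ φ a e w} → Γ ⊢ ¬̇ (e ≐ w) → Γ ⊢ ∀∈ a (φ ∨̇ ¬̇ φ) →
                      Γ ⊢ ∀∈ a φ ∨̇ ∃∈ a (¬̇ φ)
bounded-omniscience {φ = φ} e≢w decidable =
  ∃E (characteristic-function φ decidable)
     (decide-by-values (lift e≢w) (∧E₁ new) (∧E₂ (∧E₂ new)))

BOS-derivable : ∀ φ a → [] ⊢ BOS φ a
BOS-derivable φ a =
  ⇒I (∃E zero-and-one (∃E new
        (bounded-omniscience (empty-distinct (∧E₁ new) (∧E₂ new)) (lift (lift new)))))

proposition2p3 : ((φ : Fm) → Δ₀ φ → [] ⊢ Δ₀-LEM φ)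
                 × ((φ : Fm) (a : ℕ) → [] ⊢ BOS φ a)
proposition2p3 = Δ₀-decidable , BOS-derivable
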